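{- Let $n=2^\ell$, $m=2^d$ and $\lambda=m/n=2^{d-\ell}$, and let $a$ be an integer with $d\ge a\ge\max\{1,d-\ell\}$. Then there exist an integer $N$ and a set $S\subseteq\mathbb F_2^N\setminus\{0\}$ of $m$ distinct nonzero vectors such that, for a uniformly random linear map $h:\mathbb F_2^N\to\mathbb F_2^\ell$, \[ \Pr\left[|\{x\in S: h(x)=0\}|>2^a-2\right]\ge\gamma^2\lambda^a2^{ -a^2},\qquad \gamma:=\prod_{j=1}^\infty(1-2^{ -j}). \]
   Context: A uniformly random linear map is chosen uniformly among all $\mathbb F_2$-linear maps $\mathbb F_2^N\to\mathbb F_2^\ell$. -}

module Defs where

open import Data.Bool using (Bool; true; false; _xor_; _∧_)
open import Data.Bool.Properties using () renaming (_≟_ to _≟B_)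
open import Data.Nat using (ℕ; zero; suc; _+_; _*_; _^_; _∸_; _<?_; NonZero)
open import Data.Nat.Properties using (m^n≢0)
open import Data.Integer using (+_)
open import Data.Vec using (Vec; []; _∷_; replicate)
import Data.Vec as Vec
open import Data.Vec.Properties using (≡-dec)
open import Data.List using (List; []; _∷_; length; filter; concatMap)
import Data.List as List
open import Data.Rational using (ℚ; _/_; 1ℚ) renaming (_*_ to _*ℚ_; _+_ to _+ℚ_; _≤_ to _≤ℚ_)
open import Data.Product using (∃)

-- F₂ is modelled by Bool (false = 0, true = 1, xor = +, ∧ = ·).
F2^ : ℕ → Set
F2^ n = Vec Bool n

zeroVec : (n : ℕ) → F2^ n
zeroVec n = replicate n false

dot : ∀ {n} → F2^ n → F2^ n → Bool
dot []       []       = false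
dot (x ∷ xs) (y ∷ ys) = (x ∧ y) xor dot xs ys

-- An F₂-linear map F₂^N → F₂^ℓ, represented by its ℓ × N matrix (list of rows).
LinMap : ℕ → ℕ → Set
LinMap N ℓ = Vec (F2^ N) ℓ

apply : ∀ {N ℓ} → LinMap N ℓ → F2^ N → F2^ ℓ
apply h x = Vec.map (λ r → dot r x) h

allVecs : (n : ℕ) → List (F2^ n)
allVecs zero    = [] ∷ []
allVecs (suc n) = concatMap (λ v → (false ∷ v) ∷ (true ∷ v) ∷ []) (allVecs n)

-- all linear maps F₂^N → F₂^ℓ (each exactly once; there are 2^(ℓ·N) of them)
allLinMaps : (N ℓ : ℕ) → List (LinMap N ℓ)
allLinMaps N zero    = [] ∷ []
allLinMaps N (suc ℓ) = concatMap (λ r → List.map (r ∷_) (allLinMaps N ℓ)) (allVecs N)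

kernelCount : ∀ {N ℓ} → LinMap N ℓ → List (F2^ N) → ℕ
kernelCount {N} {ℓ} h S = length (filter (λ x → ≡-dec _≟B_ (apply h x) (zeroVec ℓ)) S)

-- Pr_h [ |{x ∈ S : h(x) = 0}| > 2^a − 2 ]  for h uniform among linear maps F₂^N → F₂^ℓ.
-- (count > 2^a − 2 is written 2^a < count + 2, avoiding truncated subtraction)
prob : (N ℓ a : ℕ) → List (F2^ N) → ℚ
prob N ℓ a S =
  _/_ (+ length (filter (λ h → 2 ^ a <? kernelCount h S + 2) (allLinMaps N ℓ)))
      (2 ^ (ℓ * N)) {{m^n≢0 2 (ℓ * N)}}

-- partial products γ_k = ∏_{j=1}^{k} (1 − 2^{-j}) ; γ = lim_{k→∞} γ_k (decreasing)
gammaPartial : ℕ → ℚ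
gammaPartial zero    = 1ℚ
gammaPartial (suc k) =
  gammaPartial k *ℚ (_/_ (+ (2 ^ suc k ∸ 1)) (2 ^ suc k) {{m^n≢0 2 (suc k)}})

-- γ_k² · λ^a · 2^{-a²}  with λ = 2^{d-ℓ}, i.e. γ_k² · 2^{d a} / 2^{ℓ a + a²}
boundPartial : (ℓ d a : ℕ) → ℕ → ℚ
boundPartial ℓ d a k =
  gammaPartial k *ℚ gammaPartial k
    *ℚ (_/_ (+ (2 ^ (d * a))) (2 ^ (ℓ * a + a * a)) {{m^n≢0 2 (ℓ * a + a * a)}})

-- "p ≥ lim_{k→∞} f k" for a (decreasing) rational sequence f, stated without reals:
-- for every ε = 1/(e+1) there is k with f k ≤ p + ε.
_≥lim_ : ℚ → (ℕ → ℚ) → Set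
p ≥lim f = (e : ℕ) → ∃ λ k → f k ≤ℚ p +ℚ (+ 1 / suc e)

{-# OPTIONS --safe #-}
-- Take S = {e₀} ∪ {(0, x) : 0 ≠ x ∈ F₂^d} ⊆ F₂^(d+1) and write h = (c | h₀) with h₀ : F₂^d → F₂^ℓ.
-- The vectors of S killed by h include the nonzero vectors of ker h₀, so the event occurs whenever
-- |ker h₀| = 2^a. Adding a column c to a map h₀ gives |ker (c | h₀)| = |ker h₀| + |h₀⁻¹(c)|, and every
-- fibre is empty or a coset of ker h₀; hence at least 2^(rj) ∏_{i<r} (2^ℓ − 2^i) maps on F₂^(r+j) have
-- a kernel of size 2^j, the product being the number of injective maps on F₂^r. For r = d − a ≤ ℓ this
-- product is at least γ_ℓ 2^(ℓr), which gives Pr ≥ γ_ℓ λ^a 2^(−a²) ≥ γ_ℓ² λ^a 2^(−a²), the partial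
-- bound at k = ℓ.
module Submission where

open import Defs
open import Level using (Level)
open import Function using (_∘_)
open import Data.Bool using (true; false; _xor_; _∧_; if_then_else_)
open import Data.Bool.Properties
  using ( xor-assoc; xor-comm; xor-identityˡ; xor-identityʳ; xor-same
        ; ∧-zeroʳ; ∧-identityʳ; ∧-distribˡ-xor; xor-∧-commutativeRing )
  renaming (_≟_ to _≟B_)
open import Data.Nat using (ℕ; zero; suc; _+_; _*_; _^_; _∸_; _≤_; _<_; z≤n; s≤s; _≟_; _<?_; NonZero)
open import Data.Nat.Properties
open import Data.Nat.ListAction using (sum)
open import Data.Nat.ListAction.Properties using (sum-++)
open import Data.Vec using ([]; _∷_; zipWith)
open import Data.Vec.Properties
  using (≡-dec; ∷-injective; zipWith-assoc; zipWith-comm; zipWith-identityˡ; zipWith-identityʳ)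
open import Data.List using (List; []; _∷_; _++_; length; filter; map; concatMap)
open import Data.List.Properties using (map-++; map-cong; map-∘; length-map)
open import Data.List.Relation.Unary.All as All using (All; []; _∷_)
import Data.List.Relation.Unary.All.Properties as All
import Data.List.Relation.Unary.Unique.Propositional.Properties as Unique
open import Data.List.Relation.Unary.Unique.Propositional using (Unique; []; _∷_)
import Data.Integer as ℤ
import Data.Integer.Properties as ℤP
open import Data.Rational using (_/_; toℚᵘ) renaming (_*_ to _*ℚ_; _+_ to _+ℚ_; _≤_ to _≤ℚ_)
import Data.Rational.Properties as ℚP
open import Data.Rational.Unnormalised using (mkℚᵘ; *≤*)
  renaming (_/_ to _/ᵘ_; _*_ to _*ᵘ_; _≤_ to _≤ᵘ_; _≃_ to _≃ᵘ_)
import Data.Rational.Unnormalised.Properties as ℚᵘP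
open import Data.Product using (Σ; ∃; _×_; _,_; proj₂)
open import Data.Sum using (_⊎_; inj₁; inj₂)
open import Relation.Nullary using (Dec; yes; no; does; ¬_; contradiction)
open import Relation.Nullary.Decidable using (dec-false)
open import Relation.Unary using (Decidable)
open import Relation.Binary.Definitions using (DecidableEquality)
open import Relation.Binary.PropositionalEquality
open import Algebra.Bundles using (CommutativeRing)
open import Data.Nat.Solver using (module +-*-Solver)
open +-*-Solver using (solve; _:=_; _:+_; _:*_; con)
open import Algebra.Properties.CommutativeSemigroup +-commutativeSemigroup
  using () renaming (interchange to +-interchange)
open import Algebra.Properties.CommutativeSemigroup
  (CommutativeRing.+-commutativeSemigroup xor-∧-commutativeRing)
  using () renaming (interchange to xor-interchange)

private variable
  a b p q : Level
  A : Set a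
  B : Set b
  P : Set p
  Q : Set q
  n d ℓ : ℕ

𝟙 : Dec P → ℕ
𝟙 P? = if does P? then 1 else 0

𝟙-yes : (P? : Dec P) → P → 𝟙 P? ≡ 1
𝟙-yes (yes _) _  = refl
𝟙-yes (no ¬p) p = contradiction p ¬p

𝟙-no : (P? : Dec P) → ¬ P → 𝟙 P? ≡ 0
𝟙-no (yes p) ¬p = contradiction p ¬p
𝟙-no (no _)  _  = refl

𝟙≢0⇒P : (P? : Dec P) → 𝟙 P? ≢ 0 → P
𝟙≢0⇒P (yes p) _    = p
𝟙≢0⇒P (no _)  𝟙≢0 = contradiction refl 𝟙≢0

𝟙≤1 : (P? : Dec P) → 𝟙 P? ≤ 1
𝟙≤1 (yes _) = ≤-refl
𝟙≤1 (no _)  = z≤n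

𝟙-mono : (P? : Dec P) (Q? : Dec Q) → (P → Q) → 𝟙 P? ≤ 𝟙 Q?
𝟙-mono (yes p) Q? P⇒Q = ≤-reflexive (sym (𝟙-yes Q? (P⇒Q p)))
𝟙-mono (no _)  Q? P⇒Q = z≤n

𝟙-cong : (P? : Dec P) (Q? : Dec Q) → (P → Q) → (Q → P) → 𝟙 P? ≡ 𝟙 Q?
𝟙-cong P? Q? P⇒Q Q⇒P = ≤-antisym (𝟙-mono P? Q? P⇒Q) (𝟙-mono Q? P? Q⇒P)

length-filter≡sum-𝟙 : {P : A → Set p} (P? : Decidable P) (xs : List A) →
                length (filter P? xs) ≡ sum (map (λ x → 𝟙 (P? x)) xs)
length-filter≡sum-𝟙 P? []       = refl
length-filter≡sum-𝟙 P? (x ∷ xs) with does (P? x)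
... | true  = cong suc (length-filter≡sum-𝟙 P? xs)
... | false = length-filter≡sum-𝟙 P? xs

length≡sum-map-1 : (xs : List A) → length xs ≡ sum (map (λ _ → 1) xs)
length≡sum-map-1 []       = refl
length≡sum-map-1 (x ∷ xs) = cong suc (length≡sum-map-1 xs)

sum-map-cong : {f g : A → ℕ} → (∀ x → f x ≡ g x) → (xs : List A) →
               sum (map f xs) ≡ sum (map g xs)
sum-map-cong f≗g xs = cong sum (map-cong f≗g xs)

sum-map-+ : (f g : A → ℕ) (xs : List A) →
            sum (map (λ x → f x + g x) xs) ≡ sum (map f xs) + sum (map g xs)
sum-map-+ f g []       = refl
sum-map-+ f g (x ∷ xs) = trans (cong (f x + g x +_) (sum-map-+ f g xs)) (+-interchange (f x) (g x) _ _)

sum-map-concatMap : (f : B → ℕ) (g : A → List B) (xs : List A) →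
                    sum (map f (concatMap g xs)) ≡ sum (map (λ x → sum (map f (g x))) xs)
sum-map-concatMap f g []       = refl
sum-map-concatMap f g (x ∷ xs) = begin
  sum (map f (g x ++ concatMap g xs))                ≡⟨ cong sum (map-++ f (g x) _) ⟩
  sum (map f (g x) ++ map f (concatMap g xs))         ≡⟨ sum-++ (map f (g x)) _ ⟩
  sum (map f (g x)) + sum (map f (concatMap g xs))    ≡⟨ cong (sum (map f (g x)) +_) (sum-map-concatMap f g xs) ⟩
  sum (map f (g x)) + sum (map (λ y → sum (map f (g y))) xs) ∎
  where open ≡-Reasoning

sumVecs : (n : ℕ) → (F2^ n → ℕ) → ℕ
sumVecs zero    f = f []
sumVecs (suc n) f = sumVecs n (λ v → f (false ∷ v)) + sumVecs n (λ v → f (true ∷ v))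

sum-allVecs : ∀ n (f : F2^ n → ℕ) → sum (map f (allVecs n)) ≡ sumVecs n f
sum-allVecs zero    f = +-identityʳ (f [])
sum-allVecs (suc n) f = begin
  sum (map f (allVecs (suc n)))                                      ≡⟨ sum-map-concatMap f _ (allVecs n) ⟩
  sum (map (λ v → f (false ∷ v) + (f (true ∷ v) + 0)) (allVecs n))
    ≡⟨ sum-map-cong (λ v → cong (f (false ∷ v) +_) (+-identityʳ _)) (allVecs n) ⟩
  sum (map (λ v → f (false ∷ v) + f (true ∷ v)) (allVecs n))        ≡⟨ sum-map-+ _ _ (allVecs n) ⟩
  sum (map (λ v → f (false ∷ v)) (allVecs n)) + sum (map (λ v → f (true ∷ v)) (allVecs n))
    ≡⟨ cong₂ _+_ (sum-allVecs n _) (sum-allVecs n _) ⟩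
  sumVecs (suc n) f ∎
  where open ≡-Reasoning

sumVecs-cong : ∀ n {f g : F2^ n → ℕ} → (∀ v → f v ≡ g v) → sumVecs n f ≡ sumVecs n g
sumVecs-cong zero    f≗g = f≗g []
sumVecs-cong (suc n) f≗g =
  cong₂ _+_ (sumVecs-cong n (f≗g ∘ (false ∷_))) (sumVecs-cong n (f≗g ∘ (true ∷_)))

sumVecs-mono : ∀ n {f g : F2^ n → ℕ} → (∀ v → f v ≤ g v) → sumVecs n f ≤ sumVecs n g
sumVecs-mono zero    f≤g = f≤g []
sumVecs-mono (suc n) f≤g =
  +-mono-≤ (sumVecs-mono n (f≤g ∘ (false ∷_))) (sumVecs-mono n (f≤g ∘ (true ∷_)))

sumVecs-+ : ∀ n (f g : F2^ n → ℕ) → sumVecs n (λ v → f v + g v) ≡ sumVecs n f + sumVecs n g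
sumVecs-+ zero    f g = refl
sumVecs-+ (suc n) f g =
  trans (cong₂ _+_ (sumVecs-+ n (f ∘ (false ∷_)) (g ∘ (false ∷_))) (sumVecs-+ n (f ∘ (true ∷_)) (g ∘ (true ∷_))))
        (+-interchange (sumVecs n (f ∘ (false ∷_))) _ _ _)

sumVecs-*ˡ : ∀ n c (f : F2^ n → ℕ) → c * sumVecs n f ≡ sumVecs n (λ v → c * f v)
sumVecs-*ˡ zero    c f = refl
sumVecs-*ˡ (suc n) c f = trans (*-distribˡ-+ c _ _) (cong₂ _+_ (sumVecs-*ˡ n c _) (sumVecs-*ˡ n c _))

sumVecs-const : ∀ n c → sumVecs n (λ _ → c) ≡ 2 ^ n * c
sumVecs-const zero    c = sym (+-identityʳ c)
sumVecs-const (suc n) c = begin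
  sumVecs n (λ _ → c) + sumVecs n (λ _ → c) ≡⟨ cong₂ _+_ (sumVecs-const n c) (sumVecs-const n c) ⟩
  2 ^ n * c + 2 ^ n * c                     ≡⟨ cong (λ k → 2 ^ n * c + k * c) (sym (+-identityʳ (2 ^ n))) ⟩
  2 ^ n * c + (2 ^ n + 0) * c               ≡⟨ sym (*-distribʳ-+ c (2 ^ n) (2 ^ n + 0)) ⟩
  2 ^ suc n * c ∎
  where open ≡-Reasoning

sumVecs-zero : ∀ n → sumVecs n (λ _ → 0) ≡ 0
sumVecs-zero n = trans (sumVecs-const n 0) (*-zeroʳ (2 ^ n))

sumVecs-comm : ∀ n m (f : F2^ n → F2^ m → ℕ) →
               sumVecs n (λ x → sumVecs m (f x)) ≡ sumVecs m (λ y → sumVecs n (λ x → f x y))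
sumVecs-comm zero    m f = refl
sumVecs-comm (suc n) m f =
  trans (cong₂ _+_ (sumVecs-comm n m _) (sumVecs-comm n m _)) (sym (sumVecs-+ m _ _))

f≤sumVecs : ∀ n (f : F2^ n → ℕ) v → f v ≤ sumVecs n f
f≤sumVecs zero    f []          = ≤-refl
f≤sumVecs (suc n) f (false ∷ v) = ≤-trans (f≤sumVecs n _ v) (m≤m+n _ _)
f≤sumVecs (suc n) f (true ∷ v)  = ≤-trans (f≤sumVecs n _ v) (m≤n+m _ _)

sumVecs≢0⇒ : ∀ n (f : F2^ n → ℕ) → sumVecs n f ≢ 0 → ∃ λ v → f v ≢ 0
sumVecs≢0⇒ zero    f Σ≢0 = [] , Σ≢0
sumVecs≢0⇒ (suc n) f Σ≢0 with sumVecs n (λ v → f (false ∷ v)) ≟ 0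
... | no  Σ₀≢0 = let v , fv≢0 = sumVecs≢0⇒ n _ Σ₀≢0 in false ∷ v , fv≢0
... | yes Σ₀≡0 = let v , fv≢0 = sumVecs≢0⇒ n (f ∘ (true ∷_)) (Σ≢0 ∘ cong₂ _+_ Σ₀≡0) in
  true ∷ v , fv≢0

sumLinMaps : (N ℓ : ℕ) → (LinMap N ℓ → ℕ) → ℕ
sumLinMaps N zero    f = f []
sumLinMaps N (suc ℓ) f = sumVecs N (λ r → sumLinMaps N ℓ (λ h → f (r ∷ h)))

sum-allLinMaps : ∀ N ℓ (f : LinMap N ℓ → ℕ) → sum (map f (allLinMaps N ℓ)) ≡ sumLinMaps N ℓ f
sum-allLinMaps N zero    f = +-identityʳ (f [])
sum-allLinMaps N (suc ℓ) f = begin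
  sum (map f (allLinMaps N (suc ℓ)))                                   ≡⟨ sum-map-concatMap f _ (allVecs N) ⟩
  sum (map (λ r → sum (map f (map (r ∷_) (allLinMaps N ℓ)))) (allVecs N))
    ≡⟨ sum-map-cong (λ r → trans (cong sum (sym (map-∘ (allLinMaps N ℓ)))) (sum-allLinMaps N ℓ _)) (allVecs N) ⟩
  sum (map (λ r → sumLinMaps N ℓ (λ h → f (r ∷ h))) (allVecs N))    ≡⟨ sum-allVecs N _ ⟩
  sumLinMaps N (suc ℓ) f ∎
  where open ≡-Reasoning

sumLinMaps-cong : ∀ N ℓ {f g : LinMap N ℓ → ℕ} → (∀ h → f h ≡ g h) →
                  sumLinMaps N ℓ f ≡ sumLinMaps N ℓ g
sumLinMaps-cong N zero    f≗g = f≗g []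
sumLinMaps-cong N (suc ℓ) f≗g = sumVecs-cong N (λ r → sumLinMaps-cong N ℓ (f≗g ∘ (r ∷_)))

sumLinMaps-mono : ∀ N ℓ {f g : LinMap N ℓ → ℕ} → (∀ h → f h ≤ g h) →
                  sumLinMaps N ℓ f ≤ sumLinMaps N ℓ g
sumLinMaps-mono N zero    f≤g = f≤g []
sumLinMaps-mono N (suc ℓ) f≤g = sumVecs-mono N (λ r → sumLinMaps-mono N ℓ (f≤g ∘ (r ∷_)))

sumLinMaps-+ : ∀ N ℓ (f g : LinMap N ℓ → ℕ) →
               sumLinMaps N ℓ (λ h → f h + g h) ≡ sumLinMaps N ℓ f + sumLinMaps N ℓ g
sumLinMaps-+ N zero    f g = refl
sumLinMaps-+ N (suc ℓ) f g = trans (sumVecs-cong N (λ r → sumLinMaps-+ N ℓ _ _)) (sumVecs-+ N _ _)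

sumLinMaps-*ˡ : ∀ N ℓ c (f : LinMap N ℓ → ℕ) → c * sumLinMaps N ℓ f ≡ sumLinMaps N ℓ (λ h → c * f h)
sumLinMaps-*ˡ N zero    c f = refl
sumLinMaps-*ˡ N (suc ℓ) c f =
  trans (sumVecs-*ˡ N c _) (sumVecs-cong N (λ r → sumLinMaps-*ˡ N ℓ c _))

infix 4 _≟ᵥ_
_≟ᵥ_ : DecidableEquality (F2^ n)
_≟ᵥ_ = ≡-dec _≟B_

infixl 6 _⊕_
_⊕_ : F2^ n → F2^ n → F2^ n
_⊕_ = zipWith _xor_

⊕-comm : (x y : F2^ n) → x ⊕ y ≡ y ⊕ x
⊕-comm = zipWith-comm xor-comm

⊕-identityˡ : (x : F2^ n) → zeroVec n ⊕ x ≡ x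
⊕-identityˡ = zipWith-identityˡ xor-identityˡ

⊕-self : (x : F2^ n) → x ⊕ x ≡ zeroVec n
⊕-self []      = refl
⊕-self (b ∷ x) = cong₂ _∷_ (xor-same b) (⊕-self x)

⊕-involutiveʳ : (x y : F2^ n) → x ⊕ y ⊕ y ≡ x
⊕-involutiveʳ x y = begin
  x ⊕ y ⊕ y     ≡⟨ zipWith-assoc xor-assoc x y y ⟩
  x ⊕ (y ⊕ y)   ≡⟨ cong (x ⊕_) (⊕-self y) ⟩
  x ⊕ zeroVec _ ≡⟨ zipWith-identityʳ xor-identityʳ x ⟩
  x ∎
  where open ≡-Reasoning

⊕-cancelʳ : (x y z : F2^ n) → x ⊕ z ≡ y ⊕ z → x ≡ y
⊕-cancelʳ x y z eq = begin
  x         ≡⟨ sym (⊕-involutiveʳ x z) ⟩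
  x ⊕ z ⊕ z ≡⟨ cong (_⊕ z) eq ⟩
  y ⊕ z ⊕ z ≡⟨ ⊕-involutiveʳ y z ⟩
  y ∎
  where open ≡-Reasoning

𝟙-translate : (u v w : F2^ n) → 𝟙 (u ⊕ w ≟ᵥ v ⊕ w) ≡ 𝟙 (u ≟ᵥ v)
𝟙-translate u v w = 𝟙-cong (u ⊕ w ≟ᵥ v ⊕ w) (u ≟ᵥ v) (⊕-cancelʳ u v w) (cong (_⊕ w))

sumVecs-translate : ∀ n (f : F2^ n → ℕ) v → sumVecs n (λ x → f (x ⊕ v)) ≡ sumVecs n f
sumVecs-translate zero    f []          = refl
sumVecs-translate (suc n) f (false ∷ v) =
  cong₂ _+_ (sumVecs-translate n (f ∘ (false ∷_)) v) (sumVecs-translate n (f ∘ (true ∷_)) v)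
sumVecs-translate (suc n) f (true ∷ v)  =
  trans (cong₂ _+_ (sumVecs-translate n (f ∘ (true ∷_)) v) (sumVecs-translate n (f ∘ (false ∷_)) v))
        (+-comm (sumVecs n (f ∘ (true ∷_))) _)

-- For literal heads, 𝟙 ((b ∷ u) ≟ᵥ (b′ ∷ y)) computes to 𝟙 (u ≟ᵥ y) if b = b′ and to 0 otherwise.
sumVecs-δ : ∀ n (u : F2^ n) → sumVecs n (λ y → 𝟙 (u ≟ᵥ y)) ≡ 1
sumVecs-δ zero    []          = refl
sumVecs-δ (suc n) (false ∷ u) = cong₂ _+_ (sumVecs-δ n u) (sumVecs-zero n)
sumVecs-δ (suc n) (true ∷ u)  = cong₂ _+_ (sumVecs-zero n) (sumVecs-δ n u)

dot-⊕ : (r x y : F2^ n) → dot r (x ⊕ y) ≡ dot r x xor dot r y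
dot-⊕ []      []      []      = refl
dot-⊕ (c ∷ r) (a ∷ x) (b ∷ y) = trans (cong₂ _xor_ (∧-distribˡ-xor c a b) (dot-⊕ r x y))
                                      (xor-interchange (c ∧ a) (c ∧ b) (dot r x) (dot r y))

apply-⊕ : ∀ {N} (h : LinMap N ℓ) (x y : F2^ N) → apply h (x ⊕ y) ≡ apply h x ⊕ apply h y
apply-⊕ []      x y = refl
apply-⊕ (r ∷ h) x y = cong₂ _∷_ (dot-⊕ r x y) (apply-⊕ h x y)

dot-zeroʳ : (r : F2^ n) → dot r (zeroVec n) ≡ false
dot-zeroʳ []      = refl
dot-zeroʳ (c ∷ r) = cong₂ _xor_ (∧-zeroʳ c) (dot-zeroʳ r)

apply-zero : ∀ {N} (h : LinMap N ℓ) → apply h (zeroVec N) ≡ zeroVec ℓ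
apply-zero []      = refl
apply-zero (r ∷ h) = cong₂ _∷_ (dot-zeroʳ r) (apply-zero h)

addCol : F2^ ℓ → LinMap d ℓ → LinMap (suc d) ℓ
addCol = zipWith _∷_

apply-addCol-false : (c : F2^ ℓ) (h : LinMap d ℓ) (x : F2^ d) → apply (addCol c h) (false ∷ x) ≡ apply h x
apply-addCol-false []      []      x = refl
apply-addCol-false (b ∷ c) (r ∷ h) x =
  cong₂ _∷_ (cong (_xor dot r x) (∧-zeroʳ b)) (apply-addCol-false c h x)

apply-addCol-true : (c : F2^ ℓ) (h : LinMap d ℓ) (x : F2^ d) → apply (addCol c h) (true ∷ x) ≡ c ⊕ apply h x
apply-addCol-true []      []      x = refl
apply-addCol-true (b ∷ c) (r ∷ h) x =
  cong₂ _∷_ (cong (_xor dot r x) (∧-identityʳ b)) (apply-addCol-true c h x)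

sumLinMaps-suc : ∀ d ℓ (f : LinMap (suc d) ℓ → ℕ) →
                 sumLinMaps (suc d) ℓ f ≡ sumLinMaps d ℓ (λ h → sumVecs ℓ (λ c → f (addCol c h)))
sumLinMaps-suc d zero    f = refl
sumLinMaps-suc d (suc ℓ) f = begin
  sumVecs d (λ r → sumLinMaps (suc d) ℓ (f₀ r)) + sumVecs d (λ r → sumLinMaps (suc d) ℓ (f₁ r))
    ≡⟨ cong₂ _+_ (sumVecs-cong d (λ r → sumLinMaps-suc d ℓ (f₀ r)))
                 (sumVecs-cong d (λ r → sumLinMaps-suc d ℓ (f₁ r))) ⟩
  sumVecs d (λ r → sumLinMaps d ℓ (λ h → sumVecs ℓ (λ c → f₀ r (addCol c h))))
    + sumVecs d (λ r → sumLinMaps d ℓ (λ h → sumVecs ℓ (λ c → f₁ r (addCol c h))))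
    ≡⟨ sym (sumVecs-+ d _ _) ⟩
  sumVecs d (λ r → sumLinMaps d ℓ (λ h → sumVecs ℓ (λ c → f₀ r (addCol c h)))
                 + sumLinMaps d ℓ (λ h → sumVecs ℓ (λ c → f₁ r (addCol c h))))
    ≡⟨ sumVecs-cong d (λ r → sym (sumLinMaps-+ d ℓ _ _)) ⟩
  sumLinMaps d (suc ℓ) (λ h → sumVecs (suc ℓ) (λ c → f (addCol c h))) ∎
  where
  open ≡-Reasoning
  f₀ f₁ : F2^ d → LinMap (suc d) ℓ → ℕ
  f₀ r h = f ((false ∷ r) ∷ h)
  f₁ r h = f ((true ∷ r) ∷ h)

fibreSize : LinMap d ℓ → F2^ ℓ → ℕ
fibreSize {d} h y = sumVecs d (λ x → 𝟙 (apply h x ≟ᵥ y))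

kerSize : LinMap d ℓ → ℕ
kerSize {ℓ = ℓ} h = fibreSize h (zeroVec ℓ)

fibreSize-image : (h : LinMap d ℓ) (x₀ : F2^ d) → fibreSize h (apply h x₀) ≡ kerSize h
fibreSize-image {d} {ℓ} h x₀ = begin
  sumVecs d (λ x → 𝟙 (apply h x ≟ᵥ apply h x₀))
    ≡⟨ sym (sumVecs-translate d _ x₀) ⟩
  sumVecs d (λ x → 𝟙 (apply h (x ⊕ x₀) ≟ᵥ apply h x₀))
    ≡⟨ sumVecs-cong d (λ x → cong₂ (λ u v → 𝟙 (u ≟ᵥ v)) (apply-⊕ h x x₀) (sym (⊕-identityˡ _))) ⟩
  sumVecs d (λ x → 𝟙 (apply h x ⊕ apply h x₀ ≟ᵥ zeroVec ℓ ⊕ apply h x₀))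
    ≡⟨ sumVecs-cong d (λ x → 𝟙-translate (apply h x) (zeroVec ℓ) (apply h x₀)) ⟩
  kerSize h ∎
  where open ≡-Reasoning

fibreSize≡0⊎kerSize : (h : LinMap d ℓ) (y : F2^ ℓ) → fibreSize h y ≡ 0 ⊎ fibreSize h y ≡ kerSize h
fibreSize≡0⊎kerSize {d} h y with fibreSize h y ≟ 0
... | yes fibre≡0 = inj₁ fibre≡0
... | no  fibre≢0 = let x₀ , hx₀≡y = sumVecs≢0⇒ d _ fibre≢0 in
  inj₂ (trans (cong (fibreSize h) (sym (𝟙≢0⇒P (apply h x₀ ≟ᵥ y) hx₀≡y))) (fibreSize-image h x₀))

sum-fibreSize : (h : LinMap d ℓ) → sumVecs ℓ (fibreSize h) ≡ 2 ^ d
sum-fibreSize {d} {ℓ} h = begin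
  sumVecs ℓ (λ y → sumVecs d (λ x → 𝟙 (apply h x ≟ᵥ y))) ≡⟨ sym (sumVecs-comm d ℓ _) ⟩
  sumVecs d (λ x → sumVecs ℓ (λ y → 𝟙 (apply h x ≟ᵥ y))) ≡⟨ sumVecs-cong d (λ x → sumVecs-δ ℓ (apply h x)) ⟩
  sumVecs d (λ _ → 1)                                     ≡⟨ sumVecs-const d 1 ⟩
  2 ^ d * 1                                               ≡⟨ *-identityʳ _ ⟩
  2 ^ d ∎
  where open ≡-Reasoning

kerSize-pos : (h : LinMap d ℓ) → 1 ≤ kerSize h
kerSize-pos {d} {ℓ} h = begin
  1                                         ≡⟨ sym (𝟙-yes (apply h (zeroVec d) ≟ᵥ zeroVec ℓ) (apply-zero h)) ⟩
  𝟙 (apply h (zeroVec d) ≟ᵥ zeroVec ℓ)      ≤⟨ f≤sumVecs d _ (zeroVec d) ⟩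
  kerSize h ∎
  where open ≤-Reasoning

kerSize-addCol : (c : F2^ ℓ) (h : LinMap d ℓ) → kerSize (addCol c h) ≡ kerSize h + fibreSize h c
kerSize-addCol {ℓ} {d} c h = cong₂ _+_
  (sumVecs-cong d (λ x → cong (λ u → 𝟙 (u ≟ᵥ zeroVec ℓ)) (apply-addCol-false c h x)))
  (sumVecs-cong d (λ x → begin
    𝟙 (apply (addCol c h) (true ∷ x) ≟ᵥ zeroVec ℓ)
      ≡⟨ cong₂ (λ u v → 𝟙 (u ≟ᵥ v)) (trans (apply-addCol-true c h x) (⊕-comm c _)) (sym (⊕-self c)) ⟩
    𝟙 (apply h x ⊕ c ≟ᵥ c ⊕ c)                    ≡⟨ 𝟙-translate (apply h x) c c ⟩
    𝟙 (apply h x ≟ᵥ c) ∎))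
  where open ≡-Reasoning

countKernelSize : (ℓ d m : ℕ) → ℕ
countKernelSize ℓ d m = sumLinMaps d ℓ (λ h → 𝟙 (kerSize h ≟ m))

injectiveCount : ℕ → ℕ → ℕ
injectiveCount ℓ zero    = 1
injectiveCount ℓ (suc r) = (2 ^ ℓ ∸ 2 ^ r) * injectiveCount ℓ r

kerSize-addCol≡1⇒ : (c : F2^ ℓ) (h : LinMap d ℓ) → kerSize (addCol c h) ≡ 1 → kerSize h ≡ 1
kerSize-addCol≡1⇒ c h K′≡1 =
  ≤-antisym (≤-trans (m≤m+n (kerSize h) (fibreSize h c)) (≤-reflexive (trans (sym (kerSize-addCol c h)) K′≡1)))
            (kerSize-pos h)

-- An injective h extends injectively exactly by the columns outside its image, which has 2^d points.
injective-extensions : (h : LinMap d ℓ) → kerSize h ≡ 1 →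
                       sumVecs ℓ (λ c → 𝟙 (kerSize (addCol c h) ≟ 1)) + 2 ^ d ≡ 2 ^ ℓ
injective-extensions {d} {ℓ} h K≡1 = begin
  sumVecs ℓ (λ c → 𝟙 (kerSize (addCol c h) ≟ 1)) + 2 ^ d            ≡⟨ cong₂ _+_ refl (sym (sum-fibreSize h)) ⟩
  sumVecs ℓ (λ c → 𝟙 (kerSize (addCol c h) ≟ 1)) + sumVecs ℓ (fibreSize h) ≡⟨ sym (sumVecs-+ ℓ _ _) ⟩
  sumVecs ℓ (λ c → 𝟙 (kerSize (addCol c h) ≟ 1) + fibreSize h c)     ≡⟨ sumVecs-cong ℓ one-or-other ⟩
  sumVecs ℓ (λ _ → 1)                                                ≡⟨ sumVecs-const ℓ 1 ⟩
  2 ^ ℓ * 1                                                          ≡⟨ *-identityʳ _ ⟩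
  2 ^ ℓ ∎
  where
  open ≡-Reasoning
  one-or-other : ∀ c → 𝟙 (kerSize (addCol c h) ≟ 1) + fibreSize h c ≡ 1
  one-or-other c with fibreSize≡0⊎kerSize h c
  ... | inj₁ f≡0 = cong₂ (λ k f → 𝟙 (k ≟ 1) + f) (trans (kerSize-addCol c h) (cong₂ _+_ K≡1 f≡0)) f≡0
  ... | inj₂ f≡K = cong₂ (λ k f → 𝟙 (k ≟ 1) + f) (trans (kerSize-addCol c h) (cong₂ _+_ K≡1 f≡1)) f≡1
    where f≡1 = trans f≡K K≡1

injective-extensions-count : (h : LinMap d ℓ) →
  sumVecs ℓ (λ c → 𝟙 (kerSize (addCol c h) ≟ 1)) ≡ (2 ^ ℓ ∸ 2 ^ d) * 𝟙 (kerSize h ≟ 1)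
injective-extensions-count {d} {ℓ} h with kerSize h ≟ 1
... | yes K≡1 = begin
  sumVecs ℓ (λ c → 𝟙 (kerSize (addCol c h) ≟ 1))                 ≡⟨ sym (m+n∸n≡m _ (2 ^ d)) ⟩
  sumVecs ℓ (λ c → 𝟙 (kerSize (addCol c h) ≟ 1)) + 2 ^ d ∸ 2 ^ d ≡⟨ cong (_∸ 2 ^ d) (injective-extensions h K≡1) ⟩
  2 ^ ℓ ∸ 2 ^ d                                                  ≡⟨ sym (*-identityʳ _) ⟩
  (2 ^ ℓ ∸ 2 ^ d) * 1                                            ≡⟨ cong ((2 ^ ℓ ∸ 2 ^ d) *_) (sym (𝟙-yes (kerSize h ≟ 1) K≡1)) ⟩
  (2 ^ ℓ ∸ 2 ^ d) * 𝟙 (kerSize h ≟ 1) ∎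
  where open ≡-Reasoning
... | no  K≢1 = begin
  sumVecs ℓ (λ c → 𝟙 (kerSize (addCol c h) ≟ 1))
    ≡⟨ sumVecs-cong ℓ (λ c → 𝟙-no (kerSize (addCol c h) ≟ 1) (K≢1 ∘ kerSize-addCol≡1⇒ c h)) ⟩
  sumVecs ℓ (λ _ → 0)                            ≡⟨ sumVecs-zero ℓ ⟩
  0                                              ≡⟨ sym (*-zeroʳ (2 ^ ℓ ∸ 2 ^ d)) ⟩
  (2 ^ ℓ ∸ 2 ^ d) * 0                            ≡⟨ cong ((2 ^ ℓ ∸ 2 ^ d) *_) (sym (𝟙-no (kerSize h ≟ 1) K≢1)) ⟩
  (2 ^ ℓ ∸ 2 ^ d) * 𝟙 (kerSize h ≟ 1) ∎
  where open ≡-Reasoning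

-- The kernel of a map out of F₂^0 has size 1 by computation.
countKernelSize-1 : ∀ ℓ r → countKernelSize ℓ r 1 ≡ injectiveCount ℓ r
countKernelSize-1 zero    zero    = refl
countKernelSize-1 (suc ℓ) zero    = countKernelSize-1 ℓ zero
countKernelSize-1 ℓ       (suc r) = begin
  sumLinMaps (suc r) ℓ (λ h → 𝟙 (kerSize h ≟ 1))                           ≡⟨ sumLinMaps-suc r ℓ _ ⟩
  sumLinMaps r ℓ (λ h → sumVecs ℓ (λ c → 𝟙 (kerSize (addCol c h) ≟ 1)))    ≡⟨ sumLinMaps-cong r ℓ injective-extensions-count ⟩
  sumLinMaps r ℓ (λ h → (2 ^ ℓ ∸ 2 ^ r) * 𝟙 (kerSize h ≟ 1))               ≡⟨ sym (sumLinMaps-*ˡ r ℓ (2 ^ ℓ ∸ 2 ^ r) _) ⟩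
  (2 ^ ℓ ∸ 2 ^ r) * countKernelSize ℓ r 1                                  ≡⟨ cong ((2 ^ ℓ ∸ 2 ^ r) *_) (countKernelSize-1 ℓ r) ⟩
  injectiveCount ℓ (suc r) ∎
  where open ≡-Reasoning

-- A column c extending h doubles the kernel exactly when c lies in the image, i.e. for 2^d / kerSize h columns.
doubling-extensions : (h : LinMap d ℓ) →
                      2 ^ d ≤ kerSize h * sumVecs ℓ (λ c → 𝟙 (kerSize (addCol c h) ≟ 2 * kerSize h))
doubling-extensions {d} {ℓ} h = begin
  2 ^ d                                                                 ≡⟨ sym (sum-fibreSize h) ⟩
  sumVecs ℓ (fibreSize h)                                               ≤⟨ sumVecs-mono ℓ fibre≤ ⟩
  sumVecs ℓ (λ c → kerSize h * 𝟙 (kerSize (addCol c h) ≟ 2 * kerSize h)) ≡⟨ sym (sumVecs-*ˡ ℓ (kerSize h) _) ⟩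
  kerSize h * sumVecs ℓ (λ c → 𝟙 (kerSize (addCol c h) ≟ 2 * kerSize h)) ∎
  where
  open ≤-Reasoning
  fibre≤ : ∀ c → fibreSize h c ≤ kerSize h * 𝟙 (kerSize (addCol c h) ≟ 2 * kerSize h)
  fibre≤ c with fibreSize≡0⊎kerSize h c
  ... | inj₁ f≡0 = ≤-trans (≤-reflexive f≡0) z≤n
  ... | inj₂ f≡K = ≤-reflexive (begin-equality
    fibreSize h c                                            ≡⟨ f≡K ⟩
    kerSize h                                                ≡⟨ sym (*-identityʳ _) ⟩
    kerSize h * 1                                            ≡⟨ cong (kerSize h *_) (sym (𝟙-yes (_ ≟ _) K′≡2K)) ⟩
    kerSize h * 𝟙 (kerSize (addCol c h) ≟ 2 * kerSize h) ∎)
    where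
    K′≡2K : kerSize (addCol c h) ≡ 2 * kerSize h
    K′≡2K = trans (kerSize-addCol c h) (cong (kerSize h +_) (trans f≡K (sym (+-identityʳ _))))

countKernelSize-step : ∀ ℓ d m → 2 ^ d * countKernelSize ℓ d m ≤ m * countKernelSize ℓ (suc d) (2 * m)
countKernelSize-step ℓ d m = begin
  2 ^ d * sumLinMaps d ℓ (λ h → 𝟙 (kerSize h ≟ m))                          ≡⟨ sumLinMaps-*ˡ d ℓ (2 ^ d) _ ⟩
  sumLinMaps d ℓ (λ h → 2 ^ d * 𝟙 (kerSize h ≟ m))                          ≤⟨ sumLinMaps-mono d ℓ pointwise ⟩
  sumLinMaps d ℓ (λ h → m * sumVecs ℓ (λ c → 𝟙 (kerSize (addCol c h) ≟ 2 * m))) ≡⟨ sym (sumLinMaps-*ˡ d ℓ m _) ⟩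
  m * sumLinMaps d ℓ (λ h → sumVecs ℓ (λ c → 𝟙 (kerSize (addCol c h) ≟ 2 * m))) ≡⟨ cong (m *_) (sym (sumLinMaps-suc d ℓ _)) ⟩
  m * countKernelSize ℓ (suc d) (2 * m) ∎
  where
  open ≤-Reasoning
  pointwise : (h : LinMap d ℓ) → 2 ^ d * 𝟙 (kerSize h ≟ m) ≤ m * sumVecs ℓ (λ c → 𝟙 (kerSize (addCol c h) ≟ 2 * m))
  pointwise h with kerSize h ≟ m
  ... | no  K≢m = begin
    2 ^ d * 𝟙 (kerSize h ≟ m) ≡⟨ cong (2 ^ d *_) (𝟙-no (kerSize h ≟ m) K≢m) ⟩
    2 ^ d * 0                 ≡⟨ *-zeroʳ (2 ^ d) ⟩
    0                         ≤⟨ z≤n ⟩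
    m * sumVecs ℓ (λ c → 𝟙 (kerSize (addCol c h) ≟ 2 * m)) ∎
  ... | yes K≡m = begin
    2 ^ d * 𝟙 (kerSize h ≟ m) ≡⟨ cong (2 ^ d *_) (𝟙-yes (kerSize h ≟ m) K≡m) ⟩
    2 ^ d * 1                 ≡⟨ *-identityʳ (2 ^ d) ⟩
    2 ^ d                     ≤⟨ doubling-extensions h ⟩
    kerSize h * sumVecs ℓ (λ c → 𝟙 (kerSize (addCol c h) ≟ 2 * kerSize h))
      ≡⟨ cong (λ k → k * sumVecs ℓ (λ c → 𝟙 (kerSize (addCol c h) ≟ 2 * k))) K≡m ⟩
    m * sumVecs ℓ (λ c → 𝟙 (kerSize (addCol c h) ≟ 2 * m)) ∎

countKernelSize-iterate : ∀ ℓ r j → 2 ^ (r * j) * injectiveCount ℓ r ≤ countKernelSize ℓ (j + r) (2 ^ j)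
countKernelSize-iterate ℓ r zero rewrite *-zeroʳ r =
  ≤-reflexive (trans (+-identityʳ _) (sym (countKernelSize-1 ℓ r)))
countKernelSize-iterate ℓ r (suc j) = *-cancelˡ-≤ (2 ^ j) {{m^n≢0 2 j}} (begin
  2 ^ j * (2 ^ (r * suc j) * I)           ≡⟨ exponents ⟩
  2 ^ (j + r) * (2 ^ (r * j) * I)         ≤⟨ *-monoʳ-≤ (2 ^ (j + r)) (countKernelSize-iterate ℓ r j) ⟩
  2 ^ (j + r) * countKernelSize ℓ (j + r) (2 ^ j) ≤⟨ countKernelSize-step ℓ (j + r) (2 ^ j) ⟩
  2 ^ j * countKernelSize ℓ (suc j + r) (2 ^ suc j) ∎)
  where
  open ≤-Reasoning
  I = injectiveCount ℓ r
  exponents : 2 ^ j * (2 ^ (r * suc j) * I) ≡ 2 ^ (j + r) * (2 ^ (r * j) * I)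
  exponents = begin-equality
    2 ^ j * (2 ^ (r * suc j) * I)         ≡⟨ cong (λ e → 2 ^ j * (2 ^ e * I)) (*-suc r j) ⟩
    2 ^ j * (2 ^ (r + r * j) * I)         ≡⟨ cong (λ p → 2 ^ j * (p * I)) (^-distribˡ-+-* 2 r (r * j)) ⟩
    2 ^ j * (2 ^ r * 2 ^ (r * j) * I)
      ≡⟨ solve 4 (λ a b c i → a :* (b :* c :* i) := a :* b :* (c :* i)) refl (2 ^ j) (2 ^ r) (2 ^ (r * j)) I ⟩
    2 ^ j * 2 ^ r * (2 ^ (r * j) * I)     ≡⟨ cong (_* (2 ^ (r * j) * I)) (sym (^-distribˡ-+-* 2 j r)) ⟩
    2 ^ (j + r) * (2 ^ (r * j) * I) ∎

allVecs-unique : ∀ n → Unique (allVecs n)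
allVecs-unique zero    = [] ∷ []
allVecs-unique (suc n) = unique-doubled (allVecs-unique n)
  where
  doubled : List (F2^ n) → List (F2^ (suc n))
  doubled = concatMap (λ v → (false ∷ v) ∷ (true ∷ v) ∷ [])

  fresh-doubled : ∀ {x xs} b → All (x ≢_) xs → All ((b ∷ x) ≢_) (doubled xs)
  fresh-doubled b []         = []
  fresh-doubled b (x≢y ∷ ps) = (x≢y ∘ proj₂ ∘ ∷-injective) ∷ (x≢y ∘ proj₂ ∘ ∷-injective) ∷ fresh-doubled b ps

  unique-doubled : ∀ {xs} → Unique xs → Unique (doubled xs)
  unique-doubled []           = []
  unique-doubled (x∉xs ∷ uxs) = ((λ ()) ∷ fresh-doubled false x∉xs) ∷ fresh-doubled true x∉xs ∷ unique-doubled uxs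

length-allVecs : ∀ n → length (allVecs n) ≡ 2 ^ n
length-allVecs n = begin
  length (allVecs n)                   ≡⟨ length≡sum-map-1 (allVecs n) ⟩
  sum (map (λ _ → 1) (allVecs n))      ≡⟨ sum-allVecs n _ ⟩
  sumVecs n (λ _ → 1)                  ≡⟨ sumVecs-const n 1 ⟩
  2 ^ n * 1                            ≡⟨ *-identityʳ _ ⟩
  2 ^ n ∎
  where open ≡-Reasoning

-- x ↦ (𝟙[x = 0], x) maps F₂^d onto e₀ together with the nonzero vectors of the hyperplane x₀ = 0.
embed : F2^ d → F2^ (suc d)
embed {d} x = does (x ≟ᵥ zeroVec d) ∷ x

S : (d : ℕ) → List (F2^ (suc d))
S d = map embed (allVecs d)

embed-injective : {x y : F2^ d} → embed x ≡ embed y → x ≡ y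
embed-injective = proj₂ ∘ ∷-injective

embed-nonzero : (x : F2^ d) → embed x ≢ zeroVec (suc d)
embed-nonzero {d} x with x ≟ᵥ zeroVec d
... | yes _   = λ ()
... | no  x≢0 = x≢0 ∘ proj₂ ∘ ∷-injective

embed-≢0 : {x : F2^ d} → x ≢ zeroVec d → embed x ≡ false ∷ x
embed-≢0 {d} {x} x≢0 = cong (_∷ x) (dec-false (x ≟ᵥ zeroVec d) x≢0)

length-S : ∀ d → length (S d) ≡ 2 ^ d
length-S d = trans (length-map embed (allVecs d)) (length-allVecs d)

S-unique : ∀ d → Unique (S d)
S-unique d = Unique.map⁺ embed-injective (allVecs-unique d)

S-nonzero : ∀ d → All (λ x → x ≢ zeroVec (suc d)) (S d)
S-nonzero d = All.map⁺ (All.universal embed-nonzero (allVecs d))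

-- Only the vector 0 ∈ ker h is lost when passing to S.
kerSize≤kernelCount-S+1 : (c : F2^ ℓ) (h : LinMap d ℓ) → kerSize h ≤ kernelCount (addCol c h) (S d) + 1
kerSize≤kernelCount-S+1 {ℓ} {d} c h = begin
  kerSize h                                                              ≤⟨ sumVecs-mono d pointwise ⟩
  sumVecs d (λ x → 𝟙 (apply h′ (embed x) ≟ᵥ zeroVec ℓ) + 𝟙 (zeroVec d ≟ᵥ x)) ≡⟨ sumVecs-+ d _ _ ⟩
  sumVecs d (λ x → 𝟙 (apply h′ (embed x) ≟ᵥ zeroVec ℓ)) + sumVecs d (λ x → 𝟙 (zeroVec d ≟ᵥ x))
    ≡⟨ cong₂ _+_ (sym (sum-allVecs d _)) (sumVecs-δ d (zeroVec d)) ⟩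
  sum (map (λ x → 𝟙 (apply h′ (embed x) ≟ᵥ zeroVec ℓ)) (allVecs d)) + 1  ≡⟨ cong (_+ 1) (cong sum (map-∘ (allVecs d))) ⟩
  sum (map (λ y → 𝟙 (apply h′ y ≟ᵥ zeroVec ℓ)) (S d)) + 1                ≡⟨ cong (_+ 1) (sym (length-filter≡sum-𝟙 _ (S d))) ⟩
  kernelCount h′ (S d) + 1 ∎
  where
  open ≤-Reasoning
  h′ = addCol c h
  pointwise : ∀ x → 𝟙 (apply h x ≟ᵥ zeroVec ℓ) ≤ 𝟙 (apply h′ (embed x) ≟ᵥ zeroVec ℓ) + 𝟙 (zeroVec d ≟ᵥ x)
  pointwise x = by-cases (x ≟ᵥ zeroVec d)
    where
    by-cases : Dec (x ≡ zeroVec d) → 𝟙 (apply h x ≟ᵥ zeroVec ℓ) ≤ 𝟙 (apply h′ (embed x) ≟ᵥ zeroVec ℓ) + 𝟙 (zeroVec d ≟ᵥ x)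
    by-cases (yes x≡0) = ≤-trans (𝟙≤1 (apply h x ≟ᵥ zeroVec ℓ))
                                 (≤-trans (≤-reflexive (sym (𝟙-yes (zeroVec d ≟ᵥ x) (sym x≡0)))) (m≤n+m _ _))
    by-cases (no  x≢0) = ≤-trans (≤-reflexive (cong (λ u → 𝟙 (u ≟ᵥ zeroVec ℓ))
                                                    (sym (trans (cong (apply h′) (embed-≢0 x≢0)) (apply-addCol-false c h x)))))
                                 (m≤m+n _ (𝟙 (zeroVec d ≟ᵥ x)))

countKernelSize≤eventCount : ∀ ℓ d a → 2 ^ ℓ * countKernelSize ℓ d (2 ^ a) ≤
                    length (filter (λ h → 2 ^ a <? kernelCount h (S d) + 2) (allLinMaps (suc d) ℓ))
countKernelSize≤eventCount ℓ d a = begin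
  2 ^ ℓ * countKernelSize ℓ d (2 ^ a)                             ≡⟨ sumLinMaps-*ˡ d ℓ (2 ^ ℓ) _ ⟩
  sumLinMaps d ℓ (λ h → 2 ^ ℓ * 𝟙 (kerSize h ≟ 2 ^ a))            ≡⟨ sumLinMaps-cong d ℓ (λ h → sym (sumVecs-const ℓ _)) ⟩
  sumLinMaps d ℓ (λ h → sumVecs ℓ (λ c → 𝟙 (kerSize h ≟ 2 ^ a)))
    ≤⟨ sumLinMaps-mono d ℓ (λ h → sumVecs-mono ℓ (λ c → 𝟙-mono (kerSize h ≟ 2 ^ a) (large? (addCol c h)) (large c h))) ⟩
  sumLinMaps d ℓ (λ h → sumVecs ℓ (λ c → 𝟙 (large? (addCol c h)))) ≡⟨ sym (sumLinMaps-suc d ℓ _) ⟩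
  sumLinMaps (suc d) ℓ (λ h → 𝟙 (large? h))                        ≡⟨ sym (sum-allLinMaps (suc d) ℓ _) ⟩
  sum (map (λ h → 𝟙 (large? h)) (allLinMaps (suc d) ℓ))            ≡⟨ sym (length-filter≡sum-𝟙 large? (allLinMaps (suc d) ℓ)) ⟩
  length (filter large? (allLinMaps (suc d) ℓ)) ∎
  where
  open ≤-Reasoning
  large? : (h : LinMap (suc d) ℓ) → Dec (2 ^ a < kernelCount h (S d) + 2)
  large? h = 2 ^ a <? kernelCount h (S d) + 2
  large : ∀ c (h : LinMap d ℓ) → kerSize h ≡ 2 ^ a → 2 ^ a < kernelCount (addCol c h) (S d) + 2
  large c h K≡2^a = ≤-trans (s≤s (subst (_≤ _) K≡2^a (kerSize≤kernelCount-S+1 c h)))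
                            (≤-reflexive (sym (+-suc (kernelCount (addCol c h) (S d)) 1)))

γNum γDen : ℕ → ℕ
γNum zero    = 1
γNum (suc k) = γNum k * (2 ^ suc k ∸ 1)
γDen zero    = 1
γDen (suc k) = γDen k * 2 ^ suc k

γNum≤γDen : ∀ k → γNum k ≤ γDen k
γNum≤γDen zero    = ≤-refl
γNum≤γDen (suc k) = *-mono-≤ (γNum≤γDen k) (m∸n≤m _ 1)

injectiveCount-suc-suc : ∀ ℓ r → injectiveCount (suc ℓ) (suc r) ≡ (2 ^ suc ℓ ∸ 1) * (2 ^ r * injectiveCount ℓ r)
injectiveCount-suc-suc ℓ zero    = refl
injectiveCount-suc-suc ℓ (suc r) = begin
  (2 * 2 ^ ℓ ∸ 2 * 2 ^ r) * injectiveCount (suc ℓ) (suc r)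
    ≡⟨ cong₂ _*_ (sym (*-distribˡ-∸ 2 (2 ^ ℓ) (2 ^ r))) (injectiveCount-suc-suc ℓ r) ⟩
  2 * (2 ^ ℓ ∸ 2 ^ r) * ((2 ^ suc ℓ ∸ 1) * (2 ^ r * injectiveCount ℓ r))
    ≡⟨ solve 4 (λ x c p i → con 2 :* x :* (c :* (p :* i)) := c :* (con 2 :* p :* (x :* i))) refl
             (2 ^ ℓ ∸ 2 ^ r) (2 ^ suc ℓ ∸ 1) (2 ^ r) (injectiveCount ℓ r) ⟩
  (2 ^ suc ℓ ∸ 1) * (2 ^ suc r * injectiveCount ℓ (suc r)) ∎
  where open ≡-Reasoning

-- γ_ℓ bounds ∏_{i<r} (1 − 2^{i−ℓ}) = injectiveCount ℓ r / 2^{ℓr}, a product of r of its factors.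
γ≤injectiveCount : ∀ ℓ r → r ≤ ℓ → γNum ℓ * 2 ^ (ℓ * r) ≤ injectiveCount ℓ r * γDen ℓ
γ≤injectiveCount ℓ zero _ rewrite *-zeroʳ ℓ =
  ≤-trans (≤-reflexive (*-identityʳ _)) (≤-trans (γNum≤γDen ℓ) (≤-reflexive (sym (+-identityʳ _))))
γ≤injectiveCount (suc ℓ) (suc r) (s≤s r≤ℓ) = begin
  γNum ℓ * c * 2 ^ (suc ℓ * suc r)
    ≡⟨ cong (γNum ℓ * c *_) exponents ⟩
  γNum ℓ * c * (2 ^ (ℓ * r) * Pr * Pℓ₁)
    ≡⟨ solve 5 (λ g c a p t → g :* c :* (a :* p :* t) := (g :* a) :* (c :* p :* t)) refl (γNum ℓ) c (2 ^ (ℓ * r)) Pr Pℓ₁ ⟩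
  γNum ℓ * 2 ^ (ℓ * r) * (c * Pr * Pℓ₁)
    ≤⟨ *-monoˡ-≤ (c * Pr * Pℓ₁) (γ≤injectiveCount ℓ r r≤ℓ) ⟩
  injectiveCount ℓ r * γDen ℓ * (c * Pr * Pℓ₁)
    ≡⟨ solve 5 (λ i g c p t → i :* g :* (c :* p :* t) := c :* (p :* i) :* (g :* t)) refl (injectiveCount ℓ r) (γDen ℓ) c Pr Pℓ₁ ⟩
  c * (Pr * injectiveCount ℓ r) * (γDen ℓ * Pℓ₁)
    ≡⟨ cong (_* (γDen ℓ * Pℓ₁)) (sym (injectiveCount-suc-suc ℓ r)) ⟩
  injectiveCount (suc ℓ) (suc r) * γDen (suc ℓ) ∎
  where
  open ≤-Reasoning
  c = 2 ^ suc ℓ ∸ 1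
  Pr = 2 ^ r
  Pℓ₁ = 2 ^ suc ℓ
  exponents : 2 ^ (suc ℓ * suc r) ≡ 2 ^ (ℓ * r) * Pr * Pℓ₁
  exponents = begin-equality
    2 ^ (suc ℓ * suc r)
      ≡⟨ cong (2 ^_) (solve 2 (λ l q → (con 1 :+ l) :* (con 1 :+ q) := l :* q :+ q :+ (con 1 :+ l)) refl ℓ r) ⟩
    2 ^ (ℓ * r + r + suc ℓ) ≡⟨ ^-distribˡ-+-* 2 (ℓ * r + r) (suc ℓ) ⟩
    2 ^ (ℓ * r + r) * Pℓ₁   ≡⟨ cong (_* Pℓ₁) (^-distribˡ-+-* 2 (ℓ * r) r) ⟩
    2 ^ (ℓ * r) * Pr * Pℓ₁ ∎

boundPartial≤prob-numerators : ∀ ℓ a r X → r ≤ ℓ → 2 ^ ℓ * (2 ^ (r * a) * injectiveCount ℓ r) ≤ X →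
  γNum ℓ * γNum ℓ * 2 ^ ((a + r) * a) * 2 ^ (ℓ * suc (a + r)) ≤ X * (γDen ℓ * γDen ℓ * 2 ^ (ℓ * a + a * a))
boundPartial≤prob-numerators ℓ a r X r≤ℓ count≥ = begin
  g * g * 2 ^ ((a + r) * a) * 2 ^ (ℓ * suc (a + r))
    ≡⟨ cong₂ (λ u v → g * g * u * v) e₁ e₂ ⟩
  g * g * (Paa * Pra) * (Pℓ * (Pℓa * Pℓr))
    ≡⟨ solve 7 (λ g g′ x y z u v → g :* g′ :* (x :* y) :* (z :* (u :* v)) := g :* (g′ :* v) :* (x :* y :* z :* u))
               refl g g Paa Pra Pℓ Pℓa Pℓr ⟩
  g * (g * Pℓr) * (Paa * Pra * Pℓ * Pℓa)
    ≤⟨ *-monoˡ-≤ _ (*-mono-≤ (γNum≤γDen ℓ) (γ≤injectiveCount ℓ r r≤ℓ)) ⟩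
  G * (I * G) * (Paa * Pra * Pℓ * Pℓa)
    ≡⟨ solve 7 (λ G G′ I x y z u → G :* (I :* G′) :* (x :* y :* z :* u) := z :* (y :* I) :* (G :* G′ :* (u :* x)))
               refl G G I Paa Pra Pℓ Pℓa ⟩
  Pℓ * (Pra * I) * (G * G * (Pℓa * Paa))           ≤⟨ *-monoˡ-≤ _ count≥ ⟩
  X * (G * G * (Pℓa * Paa))                        ≡⟨ cong (λ u → X * (G * G * u)) (sym (^-distribˡ-+-* 2 (ℓ * a) (a * a))) ⟩
  X * (G * G * 2 ^ (ℓ * a + a * a)) ∎
  where
  open ≤-Reasoning
  g = γNum ℓ
  G = γDen ℓ
  I = injectiveCount ℓ r
  Paa = 2 ^ (a * a)
  Pra = 2 ^ (r * a)
  Pℓ = 2 ^ ℓ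
  Pℓa = 2 ^ (ℓ * a)
  Pℓr = 2 ^ (ℓ * r)
  e₁ : 2 ^ ((a + r) * a) ≡ Paa * Pra
  e₁ = trans (cong (2 ^_) (*-distribʳ-+ a a r)) (^-distribˡ-+-* 2 (a * a) (r * a))
  e₂ : 2 ^ (ℓ * suc (a + r)) ≡ Pℓ * (Pℓa * Pℓr)
  e₂ = begin-equality
    2 ^ (ℓ * suc (a + r))      ≡⟨ cong (2 ^_) (trans (*-suc ℓ (a + r)) (cong (ℓ +_) (*-distribˡ-+ ℓ a r))) ⟩
    2 ^ (ℓ + (ℓ * a + ℓ * r))  ≡⟨ ^-distribˡ-+-* 2 ℓ _ ⟩
    Pℓ * 2 ^ (ℓ * a + ℓ * r)   ≡⟨ cong (Pℓ *_) (^-distribˡ-+-* 2 (ℓ * a) (ℓ * r)) ⟩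
    Pℓ * (Pℓa * Pℓr) ∎

γDen≢0 : ∀ k → NonZero (γDen k)
γDen≢0 zero    = _
γDen≢0 (suc k) = m*n≢0 (γDen k) (2 ^ suc k) {{γDen≢0 k}} {{m^n≢0 2 (suc k)}}

toℚᵘ-/ : ∀ m n .{{_ : NonZero n}} → toℚᵘ (ℤ.+ m / n) ≃ᵘ ℤ.+ m /ᵘ n
toℚᵘ-/ m (suc n) = ℚP.toℚᵘ-fromℚᵘ (mkℚᵘ (ℤ.+ m) n)

/ᵘ-* : ∀ m n m′ n′ .{{_ : NonZero n}} .{{_ : NonZero n′}} →
       (ℤ.+ m /ᵘ n) *ᵘ (ℤ.+ m′ /ᵘ n′) ≡ (ℤ.+ (m * m′) /ᵘ (n * n′)) {{m*n≢0 n n′}}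
/ᵘ-* m (suc n) m′ (suc n′) = cong (λ i → mkℚᵘ i (n′ + n * suc n′)) (sym (ℤP.pos-* m m′))

/ᵘ-mono-≤ : ∀ m n m′ n′ .{{_ : NonZero n}} .{{_ : NonZero n′}} → m * n′ ≤ m′ * n → ℤ.+ m /ᵘ n ≤ᵘ ℤ.+ m′ /ᵘ n′
/ᵘ-mono-≤ m (suc n) m′ (suc n′) le = *≤* (subst₂ ℤ._≤_ (ℤP.pos-* m (suc n′)) (ℤP.pos-* m′ (suc n)) (ℤ.+≤+ le))

toℚᵘ-gammaPartial : ∀ k → toℚᵘ (gammaPartial k) ≃ᵘ (ℤ.+ γNum k /ᵘ γDen k) {{γDen≢0 k}}
toℚᵘ-gammaPartial zero    = ℚᵘP.≃-refl
toℚᵘ-gammaPartial (suc k) = begin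
  toℚᵘ (gammaPartial k *ℚ (ℤ.+ (2 ^ suc k ∸ 1) / 2 ^ suc k))     ≈⟨ ℚP.toℚᵘ-homo-* (gammaPartial k) _ ⟩
  toℚᵘ (gammaPartial k) *ᵘ toℚᵘ (ℤ.+ (2 ^ suc k ∸ 1) / 2 ^ suc k) ≈⟨ ℚᵘP.*-cong (toℚᵘ-gammaPartial k) (toℚᵘ-/ _ (2 ^ suc k)) ⟩
  (ℤ.+ γNum k /ᵘ γDen k) *ᵘ (ℤ.+ (2 ^ suc k ∸ 1) /ᵘ 2 ^ suc k)    ≡⟨ /ᵘ-* (γNum k) (γDen k) _ (2 ^ suc k) ⟩
  ℤ.+ γNum (suc k) /ᵘ γDen (suc k) ∎
  where
  open ℚᵘP.≃-Reasoning
  instance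
    _ = γDen≢0 k
    _ = γDen≢0 (suc k)
    _ = m^n≢0 2 (suc k)

boundPartial≤fraction : ∀ ℓ d a k m n .{{_ : NonZero n}} →
  γNum k * γNum k * 2 ^ (d * a) * n ≤ m * (γDen k * γDen k * 2 ^ (ℓ * a + a * a)) → boundPartial ℓ d a k ≤ℚ ℤ.+ m / n
boundPartial≤fraction ℓ d a k m n numerators≤ = ℚP.toℚᵘ-cancel-≤ (begin
  toℚᵘ (γ *ℚ γ *ℚ λ^a)                                       ≃⟨ ℚP.toℚᵘ-homo-* (γ *ℚ γ) λ^a ⟩
  toℚᵘ (γ *ℚ γ) *ᵘ toℚᵘ λ^a                                  ≃⟨ ℚᵘP.*-cong (ℚP.toℚᵘ-homo-* γ γ) ℚᵘP.≃-refl ⟩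
  toℚᵘ γ *ᵘ toℚᵘ γ *ᵘ toℚᵘ λ^a
    ≃⟨ ℚᵘP.*-cong (ℚᵘP.*-cong (toℚᵘ-gammaPartial k) (toℚᵘ-gammaPartial k)) (toℚᵘ-/ _ D) ⟩
  (ℤ.+ γNum k /ᵘ γDen k) *ᵘ (ℤ.+ γNum k /ᵘ γDen k) *ᵘ (ℤ.+ 2 ^ (d * a) /ᵘ D)
    ≡⟨ cong (_*ᵘ (ℤ.+ 2 ^ (d * a) /ᵘ D)) (/ᵘ-* (γNum k) (γDen k) (γNum k) (γDen k)) ⟩
  (ℤ.+ (γNum k * γNum k) /ᵘ (γDen k * γDen k)) *ᵘ (ℤ.+ 2 ^ (d * a) /ᵘ D)
    ≡⟨ /ᵘ-* (γNum k * γNum k) (γDen k * γDen k) (2 ^ (d * a)) D ⟩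
  ℤ.+ (γNum k * γNum k * 2 ^ (d * a)) /ᵘ (γDen k * γDen k * D)  ≤⟨ /ᵘ-mono-≤ _ _ m n numerators≤ ⟩
  ℤ.+ m /ᵘ n                                                  ≃⟨ ℚᵘP.≃-sym (toℚᵘ-/ m n) ⟩
  toℚᵘ (ℤ.+ m / n) ∎)
  where
  open ℚᵘP.≤-Reasoning
  D = 2 ^ (ℓ * a + a * a)
  γ = gammaPartial k
  λ^a = ℤ.+ 2 ^ (d * a) / 2 ^ (ℓ * a + a * a)
  instance
    _ = γDen≢0 k
    _ = m^n≢0 2 (ℓ * a + a * a)
    _ = m*n≢0 (γDen k) (γDen k)
    _ = m*n≢0 (γDen k * γDen k) D

boundPartial≤prob : ∀ ℓ a r → r ≤ ℓ → boundPartial ℓ (a + r) a ℓ ≤ℚ prob (suc (a + r)) ℓ a (S (a + r))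
boundPartial≤prob ℓ a r r≤ℓ =
  boundPartial≤fraction ℓ (a + r) a ℓ eventCount (2 ^ (ℓ * suc (a + r))) {{m^n≢0 2 (ℓ * suc (a + r))}}
    (boundPartial≤prob-numerators ℓ a r eventCount r≤ℓ
      (≤-trans (*-monoʳ-≤ (2 ^ ℓ) (countKernelSize-iterate ℓ r a)) (countKernelSize≤eventCount ℓ (a + r) a)))
  where
  eventCount = length (filter (λ h → 2 ^ a <? kernelCount h (S (a + r)) + 2) (allLinMaps (suc (a + r)) ℓ))

p≤p+1/[1+e] : ∀ p e → p ≤ℚ p +ℚ ℤ.+ 1 / suc e
p≤p+1/[1+e] p e = ℚP.≤-trans (ℚP.≤-reflexive (sym (ℚP.+-identityʳ p)))
                             (ℚP.+-monoʳ-≤ p (ℚP.nonNegative⁻¹ _ {{ℚP.normalize-nonNeg 1 (suc e)}}))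

prob≥limBound : ∀ ℓ a r → r ≤ ℓ → prob (suc (a + r)) ℓ a (S (a + r)) ≥lim boundPartial ℓ (a + r) a
prob≥limBound ℓ a r r≤ℓ e =
  ℓ , ℚP.≤-trans (boundPartial≤prob ℓ a r r≤ℓ) (p≤p+1/[1+e] (prob (suc (a + r)) ℓ a (S (a + r))) e)

PropositionB3 : (ℓ d a : ℕ) → Set
PropositionB3 ℓ d a = Σ ℕ λ N → Σ (List (F2^ N)) λ S →
  length S ≡ 2 ^ d × Unique S × All (λ x → x ≢ zeroVec N) S × (prob N ℓ a S ≥lim boundPartial ℓ d a)

S-satisfiesB3 : ∀ ℓ a r → r ≤ ℓ → PropositionB3 ℓ (a + r) a
S-satisfiesB3 ℓ a r r≤ℓ =
  suc (a + r) , S (a + r) , length-S (a + r) , S-unique (a + r) , S-nonzero (a + r) , prob≥limBound ℓ a r r≤ℓ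

propositionB3 : (ℓ d a : ℕ) → 1 ≤ a → d ≤ ℓ + a → a ≤ d →
    Σ ℕ λ N → Σ (List (F2^ N)) λ S →
      length S ≡ 2 ^ d × Unique S × All (λ x → x ≢ zeroVec N) S ×
      (prob N ℓ a S ≥lim boundPartial ℓ d a)
propositionB3 ℓ d a _ d≤ℓ+a a≤d =
  subst (λ d → PropositionB3 ℓ d a) (m+[n∸m]≡n a≤d) (S-satisfiesB3 ℓ a (d ∸ a) d∸a≤ℓ)
  where
  d∸a≤ℓ : d ∸ a ≤ ℓ
  d∸a≤ℓ = ≤-trans (∸-monoˡ-≤ a d≤ℓ+a) (≤-reflexive (m+n∸n≡m ℓ a))
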